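{- Let $m,n\ge1$ and let $D$ be an $m$-Dyck path of height $n$. Then the in-degree of $D$ in the $\nu$-Tamari poset for $\nu=(NE^m)^n$ equals $n-1$ if and only if $t_i^D=h_i^D$ and $\mathrm{horiz}(r_i^D)\neq 0$ for all $1<i\le n$.
   Context: For $\nu=(NE^m)^n$ (from $(0,0)$ to $(mn,n)$, with unit north steps $N$ and east steps $E$), an $m$-Dyck path of height $n$ is a lattice path from $(0,0)$ to $(mn,n)$ with $N$ and $E$ steps lying weakly above $\nu$. For such $D$ and $i\in[n]$, $r_i^D$ is the point of $D$ immediately before its $i$-th north step. For $p=(x,y)$ on $D$, $\mathrm{horiz}(p)=X(y)-x$, where $X(y)$ is the largest $x$-coordinate of a point of $\nu$ at height $y$. The touch point $t_i^D$ is the first point of $D$ after $r_i^D$ with the same horizontal distance as $r_i^D$; the hit point $h_i^D$ is the first point of $D$ after $r_i^D$ with that horizontal distance which is either followed by an east step or is the final point $(mn,n)$. If $r_i^D$ is preceded by an east step, write $D=dEtf$ ($dE$ = subpath from $(0,0)$ to $r_i^D$, $t$ = subpath from $r_i^D$ to $t_i^D$, $f$ = the rest) and set $D\uparrow_i=dtEf$. The $\nu$-Tamari order is the partial order whose cover relations are $D\lessdot D\uparrow_i$ whenever defined; the in-degree of $D$ is the number of elements covered by $D$. -}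

module Defs where

open import Data.Nat using (ℕ; zero; suc; _+_; _*_; _∸_; _≤_; _<_)
open import Data.List using (List; []; _∷_; _++_; take; drop; length; head)
open import Data.List.Membership.Propositional using (_∈_)
open import Data.List.Relation.Unary.Unique.Propositional using (Unique)
open import Data.Maybe using (Maybe; just)
open import Data.Product using (_×_; Σ; ∃; ∃-syntax; _,_)
open import Data.Sum using (_⊎_)
open import Function.Bundles using (_⇔_)
open import Relation.Binary.PropositionalEquality using (_≡_; _≢_)
open import Relation.Nullary using (¬_)

-- Unit lattice steps: N = north (0,1), E = east (1,0).
data Step : Set where
  N E : Step

Path : Set
Path = List Step

countN : Path → ℕ
countN []       = 0
countN (N ∷ s)  = suc (countN s)
countN (E ∷ s)  = countN s

countE : Path → ℕ
countE []       = 0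
countE (N ∷ s)  = countE s
countE (E ∷ s)  = suc (countE s)

point : Path → ℕ → ℕ × ℕ
point D k = countE (take k D) , countN (take k D)

-- For ν = (N E^m)^n, the largest x-coordinate of a point of ν at height y
-- is X(y) = m*y, so horiz((x,y)) = m*y - x.  horiz m D k is horiz of the
-- k-th point of D.  (For paths weakly above ν this is never truncated.)
horiz : ℕ → Path → ℕ → ℕ
horiz m D k = m * countN (take k D) ∸ countE (take k D)

-- D is an m-Dyck path of height n: goes from (0,0) to (mn,n) and lies weakly
-- above ν = (N E^m)^n, i.e. every point (x,y) of D satisfies x ≤ X(y) = m*y.
IsDyck : ℕ → ℕ → Path → Set
IsDyck m n D =
  countN D ≡ n × countE D ≡ m * n ×
  (∀ k → countE (take k D) ≤ m * countN (take k D))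

-- IsR D i k : the k-th point of D is r_i^D, the point immediately before
-- the i-th north step (i ≥ 1).
IsR : Path → ℕ → ℕ → Set
IsR D i k = head (drop k D) ≡ just N × suc (countN (take k D)) ≡ i

EastOrFinal : Path → ℕ → Set
EastOrFinal D k = k ≡ length D ⊎ head (drop k D) ≡ just E

IsTouch : ℕ → Path → ℕ → ℕ → Set
IsTouch m D i k =
  Σ ℕ λ r → IsR D i r × r < k × k ≤ length D ×
  horiz m D k ≡ horiz m D r ×
  (∀ j → r < j → j < k → horiz m D j ≢ horiz m D r)

IsHit : ℕ → Path → ℕ → ℕ → Set
IsHit m D i k =
  Σ ℕ λ r → IsR D i r × r < k × k ≤ length D ×
  horiz m D k ≡ horiz m D r × EastOrFinal D k ×
  (∀ j → r < j → j < k → horiz m D j ≡ horiz m D r → ¬ EastOrFinal D j)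

Rot : ℕ → Path → ℕ → Path → Set
Rot m D i D' =
  Σ Path λ d → Σ Path λ t → Σ Path λ f →
  D ≡ d ++ E ∷ (t ++ f) ×
  IsR D i (suc (length d)) ×
  IsTouch m D i (suc (length d) + length t) ×
  D' ≡ d ++ t ++ E ∷ f

Covers : ℕ → ℕ → Path → Path → Set
Covers m n D D' =
  IsDyck m n D × Σ ℕ λ i → 1 ≤ i × i ≤ n × Rot m D i D'

-- InDegree m n D k : D covers exactly k elements, i.e. there is a
-- duplicate-free list enumerating exactly the elements covered by D,
-- and it has length k.
InDegree : ℕ → ℕ → Path → ℕ → Set
InDegree m n D k =
  Σ (List Path) λ L → Unique L ×
  (∀ D' → (D' ∈ L ⇔ Covers m n D' D)) × length L ≡ k

-- The condition of the theorem: for all 1 < i ≤ n, t_i^D = h_i^D and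
-- horiz(r_i^D) ≠ 0.  (t_i^D, h_i^D, r_i^D exist and are unique for an
-- m-Dyck path; we quantify over them.)
TouchHitCond : ℕ → ℕ → Path → Set
TouchHitCond m n D =
  ∀ i → 1 < i → i ≤ n →
    (∀ a b → IsTouch m D i a → IsHit m D i b → point D a ≡ point D b) ×
    (∀ r → IsR D i r → horiz m D r ≢ 0)

module Submission where

-- D covers D′ = d E t f exactly when D = D′↑ᵢ = d t E f with d ending at r_i^D,
-- t ending at t_i^D and horiz(r_i^D) > 0. Along t the path never dips below the
-- level of r_i^D, so moving the east step in front of t keeps the path above ν
-- and lowers the excursion t by one unit, preserving its first return. This
-- decomposition is unique for each i, impossible for i = 1 since horiz(r_1^D) = 0,
-- and for i > 1 exists exactly when t_i^D = h_i^D and horiz(r_i^D) ≠ 0: a positive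
-- level must be left by an east step before the path ends at level 0, and
-- t_i^D = h_i^D says that the first return already does so. Hence the covered
-- paths correspond to the indices 1 < i ≤ n satisfying the condition, and there
-- are n − 1 of them exactly when all of them do.

open import Defs
open import Data.Nat
open import Data.Nat.Properties
open import Data.Maybe using (just; nothing)
open import Data.Maybe.Properties using (just-injective)
import Data.Maybe.Properties as Maybe
open import Data.Product using (Σ; _×_; _,_; proj₁; proj₂)
open import Data.Sum using (inj₁; inj₂)
open import Data.List using (List; []; _∷_; _++_; take; drop; length; head; map; filter; fromMaybe; applyUpTo)
open import Data.List.Properties
  using (++-identityʳ; ++-assoc; take-all; length-take; length-++; length-map; length-applyUpTo; filter-notAll; ∷-injective)
open import Data.List.Membership.Propositional using (_∈_; mapWith∈)
open import Data.List.Membership.Propositional.Properties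
  using (∈-filter⁺; ∈-applyUpTo⁺; ∈-applyUpTo⁻; ∈-map⁻; map-mapWith∈; mapWith∈-cong; mapWith∈-id)
open import Data.List.Membership.DecPropositional _≟_ using (_∈?_)
import Data.List.Relation.Unary.Any.Properties as AnyP
open import Data.List.Relation.Binary.Subset.Propositional using (_⊆_)
open import Data.List.Relation.Unary.Any using (here; there)
import Data.List.Relation.Unary.Any as Any
open import Data.List.Relation.Unary.All using (All; []; _∷_)
import Data.List.Relation.Unary.All as All
import Data.List.Relation.Unary.All.Properties as All
open import Data.List.Relation.Unary.AllPairs using ([]; _∷_)
open import Data.List.Relation.Unary.Unique.Propositional using (Unique)
import Data.List.Relation.Unary.Unique.Propositional.Properties as UniqueP
open import Function.Base using (_∘_)
open import Function.Bundles using (_⇔_; mk⇔; Equivalence)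
open import Relation.Binary.Definitions using (DecidableEquality)
open import Relation.Binary.PropositionalEquality
open import Relation.Nullary using (¬_; Dec; yes; no; ¬?; contradiction)
open import Relation.Nullary.Decidable using (_×-dec_; _⊎-dec_)
open import Relation.Binary using (tri<; tri≈; tri>)
open import Relation.Unary using (Decidable)

DescendsByAtMostOne : (ℕ → ℕ) → Set
DescendsByAtMostOne f = ∀ x → f x ≤ suc (f (suc x))

FirstReturn : (ℕ → ℕ) → ℕ → ℕ → Set
FirstReturn f r k = r < k × f k ≡ f r × (∀ j → r < j → j < k → f j ≢ f r)

minimal : {P : ℕ → Set} → Decidable P → ∀ k → P k →
  Σ ℕ λ j → j ≤ k × P j × (∀ i → i < j → ¬ P i)
minimal P? zero p0 = zero , z≤n , p0 , λ _ ()
minimal P? (suc k) pk with P? zero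
... | yes p0 = zero , z≤n , p0 , λ _ ()
... | no ¬p0 with minimal (λ i → P? (suc i)) k pk
...   | j , j≤k , pj , below = suc j , s≤s j≤k , pj , λ where
          zero _ → ¬p0
          (suc i) (s≤s i<j) → below i i<j

module _ {f : ℕ → ℕ} (descends : DescendsByAtMostOne f) where

  crossing : ∀ {c a} b → a < b → c ≤ f a → f b < c →
    Σ ℕ λ k → a ≤ k × k < b × f k ≡ c × f (suc k) < c
  crossing {c} {a} (suc b) (s≤s a≤b) c≤fa fsb<c with c ≤? f b
  ... | yes c≤fb = b , a≤b , ≤-refl , ≤-antisym (≤-trans (descends b) fsb<c) c≤fb , fsb<c
  ... | no c≰fb with m≤n⇒m<n∨m≡n a≤b
  ...   | inj₂ refl = contradiction c≤fa c≰fb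
  ...   | inj₁ a<b with crossing b a<b c≤fa (≰⇒> c≰fb)
  ...     | k , a≤k , k<b , fk≡c , fsk<c = k , a≤k , m<n⇒m<1+n k<b , fk≡c , fsk<c

  -- Once f has risen after r it cannot sink below f r before returning:
  -- the first downward crossing of level f r would already be a return.
  firstReturn-floor : ∀ {r k} → f r ≤ f (suc r) → FirstReturn f r k →
    ∀ j → r ≤ j → j ≤ k → f r ≤ f j
  firstReturn-floor {r} {k} rises (_ , _ , avoids) j r≤j j≤k with f r ≤? f j
  ... | yes fr≤fj = fr≤fj
  ... | no fr≰fj with m≤n⇒m<n∨m≡n r≤j
  ...   | inj₂ refl = contradiction ≤-refl fr≰fj
  ...   | inj₁ r<j with crossing j r<j ≤-refl (≰⇒> fr≰fj)
  ...     | k′ , r≤k′ , k′<j , fk′≡fr , fsk′<fr with m≤n⇒m<n∨m≡n r≤k′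
  ...       | inj₂ refl = contradiction rises (<⇒≱ fsk′<fr)
  ...       | inj₁ r<k′ = contradiction fk′≡fr (avoids k′ r<k′ (<-≤-trans k′<j j≤k))

firstReturn-unique : ∀ {f r a b} → FirstReturn f r a → FirstReturn f r b → a ≡ b
firstReturn-unique {a = a} {b} (r<a , fa , avoidsᵃ) (r<b , fb , avoidsᵇ) with <-cmp a b
... | tri< a<b _ _ = contradiction fa (avoidsᵇ a r<a a<b)
... | tri≈ _ a≡b _ = a≡b
... | tri> _ _ b<a = contradiction fb (avoidsᵃ b r<b b<a)

firstReturn-exists : ∀ f {r k} → r < k → f k ≡ f r → Σ ℕ λ k′ → k′ ≤ k × FirstReturn f r k′
firstReturn-exists f {r} r<k fk≡fr
  with minimal (λ j → r <? j ×-dec f j ≟ f r) _ (r<k , fk≡fr)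
... | k′ , k′≤k , (r<k′ , fk′≡fr) , below = k′ , k′≤k , r<k′ , fk′≡fr , λ j r<j j<k′ fj≡fr → below j j<k′ (r<j , fj≡fr)

firstReturn-suc : ∀ {f g p q} → (∀ j → j ≤ q → f (p + j) ≡ suc (g (suc p + j))) →
  FirstReturn f p (p + q) ⇔ FirstReturn g (suc p) (suc p + q)
firstReturn-suc {f} {g} {p} {q} shift = mk⇔ up down
  where
  shift′ : ∀ j → p ≤ j → j ≤ p + q → f j ≡ suc (g (suc j))
  shift′ j p≤j j≤p+q with m≤n⇒∃[o]m+o≡n p≤j
  ... | o , refl = shift o (+-cancelˡ-≤ p o q j≤p+q)
  start : f p ≡ suc (g (suc p))
  start = shift′ p ≤-refl (m≤m+n p q)
  end : f (p + q) ≡ suc (g (suc p + q))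
  end = shift′ (p + q) (m≤m+n p q) ≤-refl
  up : FirstReturn f p (p + q) → FirstReturn g (suc p) (suc p + q)
  up (p<k , ret , avoids) = s<s p<k , suc-injective (trans (sym end) (trans ret start)) , avoids′
    where
    avoids′ : ∀ j → suc p < j → j < suc p + q → g j ≢ g (suc p)
    avoids′ (suc j) (s<s p<j) (s<s j<k) e =
      avoids j p<j j<k (trans (shift′ j (<⇒≤ p<j) (<⇒≤ j<k)) (trans (cong suc e) (sym start)))
  down : FirstReturn g (suc p) (suc p + q) → FirstReturn f p (p + q)
  down (s<s p<k , ret , avoids) = p<k , trans end (trans (cong suc ret) (sym start)) ,
    λ j p<j j<k e → avoids (suc j) (s<s p<j) (s<s j<k)
      (suc-injective (trans (sym (shift′ j (<⇒≤ p<j) (<⇒≤ j<k))) (trans e start)))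

module _ {a} {A : Set a} where

  ++-injective : ∀ (xs ys : List A) {us vs} → length xs ≡ length ys → xs ++ us ≡ ys ++ vs →
    xs ≡ ys × us ≡ vs
  ++-injective []       []       _   eq = refl , eq
  ++-injective (x ∷ xs) (y ∷ ys) len eq with ∷-injective eq
  ... | refl , eq′ with ++-injective xs ys (suc-injective len) eq′
  ...   | refl , us≡vs = refl , us≡vs

  take-length+-++ : ∀ (xs ys : List A) k → take (length xs + k) (xs ++ ys) ≡ xs ++ take k ys
  take-length+-++ []       ys k = refl
  take-length+-++ (x ∷ xs) ys k = cong (x ∷_) (take-length+-++ xs ys k)

  take-++-≤ : ∀ (xs ys : List A) {k} → k ≤ length xs → take k (xs ++ ys) ≡ take k xs
  take-++-≤ xs       ys {zero}  _         = refl
  take-++-≤ (x ∷ xs) ys {suc k} (s≤s k≤n) = cong (x ∷_) (take-++-≤ xs ys k≤n)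

  drop-length-++ : ∀ (xs ys : List A) → drop (length xs) (xs ++ ys) ≡ ys
  drop-length-++ []       ys = refl
  drop-length-++ (x ∷ xs) ys = drop-length-++ xs ys

  drop-length+-++ : ∀ (xs ys : List A) k → drop (length xs + k) (xs ++ ys) ≡ drop k ys
  drop-length+-++ []       ys k = refl
  drop-length+-++ (x ∷ xs) ys k = drop-length+-++ xs ys k

  take-length-++ : ∀ (xs ys : List A) → take (length xs) (xs ++ ys) ≡ xs
  take-length-++ []       ys = refl
  take-length-++ (x ∷ xs) ys = cong (x ∷_) (take-length-++ xs ys)

  take-length+-++-∷ : ∀ (xs : List A) y ys k → take (suc (length xs + k)) (xs ++ y ∷ ys) ≡ xs ++ y ∷ take k ys
  take-length+-++-∷ []       y ys k = refl
  take-length+-++-∷ (x ∷ xs) y ys k = cong (x ∷_) (take-length+-++-∷ xs y ys k)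

  drop-length-++-∷ : ∀ (xs : List A) y ys → drop (suc (length xs)) (xs ++ y ∷ ys) ≡ ys
  drop-length-++-∷ []       y ys = refl
  drop-length-++-∷ (x ∷ xs) y ys = drop-length-++-∷ xs y ys

  take-suc-head : ∀ (xs : List A) k → take (suc k) xs ≡ take k xs ++ fromMaybe (head (drop k xs))
  take-suc-head []       zero    = refl
  take-suc-head []       (suc k) = refl
  take-suc-head (x ∷ xs) zero    = refl
  take-suc-head (x ∷ xs) (suc k) = cong (x ∷_) (take-suc-head xs k)

  head-drop⇒< : ∀ (xs : List A) k {x} → head (drop k xs) ≡ just x → k < length xs
  head-drop⇒< (_ ∷ _)  zero    _ = s≤s z≤n
  head-drop⇒< (_ ∷ xs) (suc k) h = s≤s (head-drop⇒< xs k h)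

  splitAt₃ : ∀ (xs : List A) {x} r k → r ≤ k → head (drop k xs) ≡ just x →
    Σ (List A) λ us → Σ (List A) λ vs → Σ (List A) λ ws →
      xs ≡ us ++ vs ++ x ∷ ws × length us ≡ r × length us + length vs ≡ k
  splitAt₃ (y ∷ ys) zero zero _ refl = [] , [] , ys , refl , refl , refl
  splitAt₃ (y ∷ ys) zero (suc k) _ h with splitAt₃ ys zero k z≤n h
  ... | [] , vs , ws , refl , _ , refl = [] , y ∷ vs , ws , refl , refl , refl
  splitAt₃ (y ∷ ys) (suc r) (suc k) (s≤s r≤k) h with splitAt₃ ys r k r≤k h
  ... | us , vs , ws , refl , refl , refl = y ∷ us , vs , ws , refl , refl , refl

  unique-map-injectiveOn : ∀ {b ℓ} {B : Set b} {P : A → Set ℓ} {f : A → B} →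
    (∀ {x y} → P x → P y → f x ≡ f y → x ≡ y) →
    ∀ {xs} → All P xs → Unique xs → Unique (map f xs)
  unique-map-injectiveOn injective []         []         = []
  unique-map-injectiveOn injective (px ∷ pxs) (x∉ ∷ uxs) =
    All.map⁺ (All.zipWith (λ (py , x≢y) fx≡fy → x≢y (injective px py fx≡fy)) (pxs , x∉))
    ∷ unique-map-injectiveOn injective pxs uxs

  module _ (_≟_ : DecidableEquality A) where

    unique-⊆⇒length≤ : ∀ {xs ys : List A} → Unique xs → xs ⊆ ys → length xs ≤ length ys
    unique-⊆⇒length≤ {[]}              _            _     = z≤n
    unique-⊆⇒length≤ {x ∷ xs} {ys} (x∉xs ∷ uxs) xs⊆ys = begin-strict
      length xs                             ≤⟨ unique-⊆⇒length≤ uxs xs⊆rest ⟩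
      length (filter (λ y → ¬? (x ≟ y)) ys) <⟨ filter-notAll _ ys (Any.map (λ x≡y x≢y → x≢y x≡y) (xs⊆ys (here refl))) ⟩
      length ys                             ∎
      where
      open ≤-Reasoning
      xs⊆rest : xs ⊆ filter (λ y → ¬? (x ≟ y)) ys
      xs⊆rest z∈xs = ∈-filter⁺ (λ y → ¬? (x ≟ y)) (xs⊆ys (there z∈xs)) (All.lookup x∉xs z∈xs)

_≟ₛ_ : DecidableEquality Step
N ≟ₛ N = yes refl
N ≟ₛ E = no λ ()
E ≟ₛ N = no λ ()
E ≟ₛ E = yes refl

countN-N : ∀ (a b : Path) → countN (a ++ N ∷ b) ≡ suc (countN (a ++ b))
countN-N []      b = refl
countN-N (N ∷ a) b = cong suc (countN-N a b)
countN-N (E ∷ a) b = countN-N a b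

countE-N : ∀ (a b : Path) → countE (a ++ N ∷ b) ≡ countE (a ++ b)
countE-N []      b = refl
countE-N (N ∷ a) b = countE-N a b
countE-N (E ∷ a) b = cong suc (countE-N a b)

countN-E : ∀ (a b : Path) → countN (a ++ E ∷ b) ≡ countN (a ++ b)
countN-E []      b = refl
countN-E (N ∷ a) b = cong suc (countN-E a b)
countN-E (E ∷ a) b = countN-E a b

countE-E : ∀ (a b : Path) → countE (a ++ E ∷ b) ≡ suc (countE (a ++ b))
countE-E []      b = refl
countE-E (N ∷ a) b = countE-E a b
countE-E (E ∷ a) b = cong suc (countE-E a b)

countN+countE≡length : ∀ (D : Path) → countN D + countE D ≡ length D
countN+countE≡length []      = refl
countN+countE≡length (N ∷ D) = cong suc (countN+countE≡length D)
countN+countE≡length (E ∷ D) = trans (+-suc (countN D) (countE D)) (cong suc (countN+countE≡length D))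

countN-take-mono : ∀ (D : Path) {k l} → k ≤ l → countN (take k D) ≤ countN (take l D)
countN-take-mono D       {zero}           _         = z≤n
countN-take-mono []      {suc k} {suc l} _          = z≤n
countN-take-mono (N ∷ D) {suc k} {suc l} (s≤s k≤l) = s≤s (countN-take-mono D k≤l)
countN-take-mono (E ∷ D) {suc k} {suc l} (s≤s k≤l) = countN-take-mono D k≤l

point-injective : ∀ (D : Path) {a b} → a ≤ length D → b ≤ length D → point D a ≡ point D b → a ≡ b
point-injective D {a} {b} a≤ b≤ eq = begin
  a                                              ≡⟨ sym (length-take≤ a a≤) ⟩
  length (take a D)                              ≡⟨ sym (countN+countE≡length (take a D)) ⟩
  countN (take a D) + countE (take a D)          ≡⟨ cong₂ _+_ (cong proj₂ eq) (cong proj₁ eq) ⟩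
  countN (take b D) + countE (take b D)          ≡⟨ countN+countE≡length (take b D) ⟩
  length (take b D)                              ≡⟨ length-take≤ b b≤ ⟩
  b                                              ∎
  where
  open ≡-Reasoning
  length-take≤ : ∀ k → k ≤ length D → length (take k D) ≡ k
  length-take≤ k k≤ = trans (length-take k D) (m≤n⇒m⊓n≡m k≤)

module _ (m : ℕ) where

  excess : Path → ℕ
  excess T = m * countN T ∸ countE T

  Above : Path → Set
  Above T = countE T ≤ m * countN T

  excess-N : ∀ a b → excess (a ++ b) ≤ excess (a ++ N ∷ b)
  excess-N a b rewrite countN-N a b | countE-N a b =
    ∸-monoˡ-≤ (countE (a ++ b)) (*-monoʳ-≤ m (n≤1+n (countN (a ++ b))))

  excess-E : ∀ a b → excess (a ++ E ∷ b) ≡ excess (a ++ b) ∸ 1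
  excess-E a b rewrite countN-E a b | countE-E a b =
    trans (cong (m * countN (a ++ b) ∸_) (+-comm 1 (countE (a ++ b))))
          (sym (∸-+-assoc (m * countN (a ++ b)) (countE (a ++ b)) 1))

  above-E⇒excess : ∀ a b → Above (a ++ E ∷ b) → excess (a ++ b) ≡ suc (excess (a ++ E ∷ b))
  above-E⇒excess a b above rewrite countN-E a b | countE-E a b = +-∸-assoc 1 above

  excess≢0⇒above-E : ∀ a b → excess (a ++ b) ≢ 0 → Above (a ++ E ∷ b)
  excess≢0⇒above-E a b excess≢0 rewrite countN-E a b | countE-E a b = m∸n≢0⇒n<m excess≢0

  excess-extend : ∀ T ms → ms ≢ just E → excess T ≤ excess (T ++ fromMaybe ms)
  excess-extend T nothing  _   = ≤-reflexive (cong excess (sym (++-identityʳ T)))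
  excess-extend T (just N) _   = subst (λ S → excess S ≤ excess (T ++ N ∷ [])) (++-identityʳ T) (excess-N T [])
  excess-extend T (just E) ≢E = contradiction refl ≢E

  excess-descends : ∀ T ms → excess T ≤ suc (excess (T ++ fromMaybe ms))
  excess-descends T (just E) = begin
    excess T                   ≤⟨ m≤n+m∸n (excess T) 1 ⟩
    suc (excess T ∸ 1)         ≡⟨ cong (λ S → suc (excess S ∸ 1)) (sym (++-identityʳ T)) ⟩
    suc (excess (T ++ []) ∸ 1) ≡⟨ cong suc (sym (excess-E T [])) ⟩
    suc (excess (T ++ E ∷ [])) ∎
    where open ≤-Reasoning
  excess-descends T nothing  = m≤n⇒m≤1+n (excess-extend T nothing λ ())
  excess-descends T (just N) = m≤n⇒m≤1+n (excess-extend T (just N) λ ())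

  horiz-suc : ∀ D x → horiz m D (suc x) ≡ excess (take x D ++ fromMaybe (head (drop x D)))
  horiz-suc D x = cong excess (take-suc-head D x)

  horiz-descends : ∀ D → DescendsByAtMostOne (horiz m D)
  horiz-descends D x = subst (λ h → horiz m D x ≤ suc h) (sym (horiz-suc D x))
                             (excess-descends (take x D) (head (drop x D)))

  horiz-≤-unless-E : ∀ D x → head (drop x D) ≢ just E → horiz m D x ≤ horiz m D (suc x)
  horiz-≤-unless-E D x ≢E = subst (horiz m D x ≤_) (sym (horiz-suc D x))
                                  (excess-extend (take x D) (head (drop x D)) ≢E)

  horiz-N : ∀ D x → head (drop x D) ≡ just N → horiz m D x ≤ horiz m D (suc x)
  horiz-N D x ≡N = horiz-≤-unless-E D x (λ ≡E → contradiction (just-injective (trans (sym ≡N) ≡E)) λ ())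

  horiz-decrease⇒E : ∀ D x → horiz m D (suc x) < horiz m D x → head (drop x D) ≡ just E
  horiz-decrease⇒E D x decrease with Maybe.≡-dec _≟ₛ_ (head (drop x D)) (just E)
  ... | yes ≡E = ≡E
  ... | no ≢E = contradiction (horiz-≤-unless-E D x ≢E) (<⇒≱ decrease)

  horiz-final : ∀ {n} D → IsDyck m n D → horiz m D (length D) ≡ 0
  horiz-final {n} D (#N , #E , _) = begin
    excess (take (length D) D) ≡⟨ cong excess (take-all (length D) D ≤-refl) ⟩
    m * countN D ∸ countE D    ≡⟨ cong₂ (λ y x → m * y ∸ x) #N #E ⟩
    m * n ∸ m * n              ≡⟨ n∸n≡0 (m * n) ⟩
    0                          ∎
    where open ≡-Reasoning

IsR⇒countN-suc : ∀ D {i r} → IsR D i r → countN (take (suc r) D) ≡ i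
IsR⇒countN-suc D {r = r} (≡N , count) rewrite take-suc-head D r | ≡N =
  trans (countN-N (take r D) []) (trans (cong (suc ∘ countN) (++-identityʳ (take r D))) count)

IsR-increasing : ∀ D {i j a b} → IsR D i a → IsR D j b → a < b → i < j
IsR-increasing D {i} {j} {a} {b} Rᵃ (_ , countᵇ) a<b = begin-strict
  i                         ≡⟨ sym (IsR⇒countN-suc D Rᵃ) ⟩
  countN (take (suc a) D)   ≤⟨ countN-take-mono D a<b ⟩
  countN (take b D)         <⟨ n<1+n _ ⟩
  suc (countN (take b D))   ≡⟨ countᵇ ⟩
  j                         ∎
  where open ≤-Reasoning

IsR-unique : ∀ D {i a b} → IsR D i a → IsR D i b → a ≡ b
IsR-unique D {a = a} {b} Rᵃ Rᵇ with <-cmp a b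
... | tri< a<b _ _ = contradiction (IsR-increasing D Rᵃ Rᵇ a<b) (n≮n _)
... | tri≈ _ a≡b _ = a≡b
... | tri> _ _ b<a = contradiction (IsR-increasing D Rᵇ Rᵃ b<a) (n≮n _)

IsR-exists : ∀ (D : Path) {i} → 1 ≤ i → i ≤ countN D → Σ ℕ (IsR D i)
IsR-exists (N ∷ D) {suc zero}    _ _         = 0 , refl , refl
IsR-exists (N ∷ D) {suc (suc i)} _ (s≤s i<) with IsR-exists D {suc i} (s≤s z≤n) i<
... | r , ≡N , count = suc r , ≡N , cong suc count
IsR-exists (E ∷ D) 1≤i i≤ with IsR-exists D 1≤i i≤
... | r , ≡N , count = suc r , ≡N , count

IsR⇒< : ∀ D {i r} → IsR D i r → r < length D
IsR⇒< D {r = r} (≡N , _) = head-drop⇒< D r ≡N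

eastOrFinal? : ∀ D k → Dec (EastOrFinal D k)
eastOrFinal? D k = k ≟ length D ⊎-dec Maybe.≡-dec _≟ₛ_ (head (drop k D)) (just E)

module _ (m : ℕ) where

  touch⇒firstReturn : ∀ D {i r k} → IsR D i r → IsTouch m D i k → FirstReturn (horiz m D) r k
  touch⇒firstReturn D {r = r} R (r′ , R′ , r′<k , _ , ret , avoids) with IsR-unique D {a = r′} {r} R′ R
  ... | refl = r′<k , ret , avoids

  firstReturn⇒touch : ∀ D {i r k} → IsR D i r → k ≤ length D → FirstReturn (horiz m D) r k → IsTouch m D i k
  firstReturn⇒touch D R k≤ (r<k , ret , avoids) = _ , R , r<k , k≤ , ret , avoids

  touch-unique : ∀ D {i a b} → IsTouch m D i a → IsTouch m D i b → a ≡ b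
  touch-unique D Tᵃ@(r , R , _) Tᵇ =
    firstReturn-unique (touch⇒firstReturn D {r = r} R Tᵃ) (touch⇒firstReturn D {r = r} R Tᵇ)

  hit-at-touch : ∀ D {i k b} → IsTouch m D i k → EastOrFinal D k → IsHit m D i b → b ≡ k
  hit-at-touch D {k = k} {b} (r , R , r<k , _ , ret , avoids) eofᵏ (r′ , R′ , r′<b , _ , retᵇ , _ , notEarlier)
    with IsR-unique D {a = r′} {r} R′ R
  ... | refl with <-cmp b k
  ...   | tri< b<k _ _ = contradiction retᵇ (avoids b r′<b b<k)
  ...   | tri≈ _ b≡k _ = b≡k
  ...   | tri> _ _ k<b = contradiction eofᵏ (notEarlier k r<k k<b ret)

  hit-exists : ∀ D {i r k} → IsR D i r → r < k → k ≤ length D →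
    horiz m D k ≡ horiz m D r → EastOrFinal D k → Σ ℕ (IsHit m D i)
  hit-exists D {r = r} R r<k k≤ ret eof
    with minimal (λ j → (r <? j ×-dec horiz m D j ≟ horiz m D r) ×-dec eastOrFinal? D j) _ ((r<k , ret) , eof)
  ... | b , b≤k , ((r<b , retᵇ) , eofᵇ) , below =
    b , r , R , r<b , ≤-trans b≤k k≤ , retᵇ , eofᵇ , λ j r<j j<b retʲ eofʲ → below j j<b ((r<j , retʲ) , eofʲ)

countN-E-swap : ∀ (d t g : Path) → countN (d ++ E ∷ (t ++ g)) ≡ countN (d ++ t ++ E ∷ g)
countN-E-swap d t g = begin
  countN (d ++ E ∷ (t ++ g)) ≡⟨ countN-E d (t ++ g) ⟩
  countN (d ++ t ++ g)       ≡⟨ cong countN (sym (++-assoc d t g)) ⟩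
  countN ((d ++ t) ++ g)     ≡⟨ sym (countN-E (d ++ t) g) ⟩
  countN ((d ++ t) ++ E ∷ g) ≡⟨ cong countN (++-assoc d t (E ∷ g)) ⟩
  countN (d ++ t ++ E ∷ g)   ∎
  where open ≡-Reasoning

countE-E-swap : ∀ (d t g : Path) → countE (d ++ E ∷ (t ++ g)) ≡ countE (d ++ t ++ E ∷ g)
countE-E-swap d t g = begin
  countE (d ++ E ∷ (t ++ g))     ≡⟨ countE-E d (t ++ g) ⟩
  suc (countE (d ++ t ++ g))     ≡⟨ cong (suc ∘ countE) (sym (++-assoc d t g)) ⟩
  suc (countE ((d ++ t) ++ g))   ≡⟨ sym (countE-E (d ++ t) g) ⟩
  countE ((d ++ t) ++ E ∷ g)     ≡⟨ cong countE (++-assoc d t (E ∷ g)) ⟩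
  countE (d ++ t ++ E ∷ g)       ∎
  where open ≡-Reasoning

above-E-swap : ∀ m (d t g : Path) → Above m (d ++ t ++ E ∷ g) → Above m (d ++ E ∷ (t ++ g))
above-E-swap m d t g = subst₂ (λ e n → e ≤ m * n) (sym (countE-E-swap d t g)) (sym (countN-E-swap d t g))

segment-starts-N : ∀ m D {i r} (b c : Path) → drop r D ≡ b ++ c → IsR D i r →
  IsTouch m D i (r + length b) → Σ Path λ s → b ≡ N ∷ s
segment-starts-N m D {r = r} [] c _ R (r′ , R′ , r′<r+0 , _) =
  contradiction (subst₂ _<_ (IsR-unique D R′ R) (+-identityʳ r) r′<r+0) (n≮n r)
segment-starts-N m D (E ∷ s) c split (≡N , _) _ = contradiction (trans (sym (cong head split)) ≡N) λ ()
segment-starts-N m D (N ∷ s) c _     _        _ = s , refl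

-- D = (d E t f)↑ᵢ, presented as D = d t E f.
record Lowering (m : ℕ) (D : Path) (i : ℕ) : Set where
  field
    d t f     : Path
    split     : D ≡ d ++ t ++ E ∷ f
    r-at      : IsR D i (length d)
    touch-at  : IsTouch m D i (length d + length t)
    horiz-r≢0 : horiz m D (length d) ≢ 0

  lowered : Path
  lowered = d ++ E ∷ (t ++ f)

open Lowering using (lowered)

data Position (p q : ℕ) : ℕ → Set where
  before : ∀ {k} → k ≤ p → Position p q k
  inside : ∀ {j} → j ≤ q → Position p q (suc (p + j))
  after  : ∀ j → Position p q (suc (p + (q + j)))

position : ∀ p q k → Position p q k
position p q k with k ≤? p
... | yes k≤p = before k≤p
... | no k≰p with m≤n⇒∃[o]m+o≡n (≰⇒> k≰p)
...   | j , refl with j ≤? q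
...     | yes j≤q = inside j≤q
...     | no j≰q with m≤n⇒∃[o]m+o≡n (<⇒≤ (≰⇒> j≰q))
...       | j′ , refl = after j′

module Rotation (m : ℕ) (d s f : Path) where

  t up down : Path
  t    = N ∷ s
  up   = d ++ t ++ E ∷ f
  down = d ++ E ∷ (t ++ f)

  p q : ℕ
  p = length d
  q = length t

  take-up : ∀ {j} → j ≤ q → take (p + j) up ≡ d ++ take j t
  take-up {j} j≤q = trans (take-length+-++ d (t ++ E ∷ f) j) (cong (d ++_) (take-++-≤ t (E ∷ f) j≤q))

  take-down : ∀ {j} → j ≤ q → take (suc (p + j)) down ≡ d ++ E ∷ take j t
  take-down {j} j≤q = trans (take-length+-++-∷ d E (t ++ f) j) (cong (λ x → d ++ E ∷ x) (take-++-≤ t f j≤q))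

  horiz-shift : ∀ {j} → j ≤ q → Above m (d ++ E ∷ take j t) →
    horiz m up (p + j) ≡ suc (horiz m down (suc (p + j)))
  horiz-shift {j} j≤q above = begin
    excess m (take (p + j) up)              ≡⟨ cong (excess m) (take-up j≤q) ⟩
    excess m (d ++ take j t)                ≡⟨ above-E⇒excess m d (take j t) above ⟩
    suc (excess m (d ++ E ∷ take j t))      ≡⟨ cong (suc ∘ excess m) (sym (take-down j≤q)) ⟩
    suc (excess m (take (suc (p + j)) down)) ∎
    where open ≡-Reasoning

  firstReturn-up⇔down : (∀ j → j ≤ q → Above m (d ++ E ∷ take j t)) →
    FirstReturn (horiz m up) p (p + q) ⇔ FirstReturn (horiz m down) (suc p) (suc p + q)
  firstReturn-up⇔down above = firstReturn-suc (λ j j≤q → horiz-shift j≤q (above j j≤q))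

  IsR-up⇔down : ∀ {i} → IsR up i p ⇔ IsR down i (suc p)
  IsR-up⇔down = mk⇔ (λ (_ , count) → head-down , trans (cong suc (trans count-down (sym count-up))) count)
                    (λ (_ , count) → head-up , trans (cong suc (trans count-up (sym count-down))) count)
    where
    head-up : head (drop p up) ≡ just N
    head-up = cong head (drop-length-++ d (t ++ E ∷ f))
    head-down : head (drop (suc p) down) ≡ just N
    head-down = cong head (drop-length-++-∷ d E (t ++ f))
    count-up : countN (take p up) ≡ countN d
    count-up = cong countN (take-length-++ d (t ++ E ∷ f))
    count-down : countN (take (suc p) down) ≡ countN d
    count-down = begin
      countN (take (suc p) down)       ≡⟨ cong (λ k → countN (take (suc k) down)) (sym (+-identityʳ p)) ⟩
      countN (take (suc (p + 0)) down) ≡⟨ cong countN (take-down z≤n) ⟩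
      countN (d ++ E ∷ [])             ≡⟨ countN-E d [] ⟩
      countN (d ++ [])                 ≡⟨ cong countN (++-identityʳ d) ⟩
      countN d                         ∎
      where open ≡-Reasoning

  up-bound : p + q ≤ length up
  up-bound = begin
    p + q                        ≤⟨ +-monoʳ-≤ p (m≤m+n q _) ⟩
    p + (q + length (E ∷ f))     ≡⟨ cong (p +_) (sym (length-++ t)) ⟩
    p + length (t ++ E ∷ f)      ≡⟨ sym (length-++ d) ⟩
    length up                    ∎
    where open ≤-Reasoning

  down-bound : suc p + q ≤ length down
  down-bound = begin
    suc (p + q)                  ≤⟨ s≤s (+-monoʳ-≤ p (m≤m+n q (length f))) ⟩
    suc (p + (q + length f))     ≡⟨ sym (+-suc p _) ⟩
    p + suc (q + length f)       ≡⟨ cong (λ x → p + suc x) (sym (length-++ t)) ⟩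
    p + length (E ∷ (t ++ f))    ≡⟨ sym (length-++ d) ⟩
    length down                  ∎
    where open ≤-Reasoning

  module _ {n : ℕ} where

    dyck-down : IsDyck m n up → (∀ j → j ≤ q → Above m (d ++ E ∷ take j t)) → IsDyck m n down
    dyck-down (#N , #E , aboveᵘ) aboveᵗ = trans (countN-E-swap d t f) #N , trans (countE-E-swap d t f) #E , aboveᵈ
      where
      aboveᵈ : ∀ k → Above m (take k down)
      aboveᵈ k with position p q k
      ... | before k≤p = subst (Above m) (trans (take-++-≤ d _ k≤p) (sym (take-++-≤ d _ k≤p))) (aboveᵘ k)
      ... | inside j≤q = subst (Above m) (sym (take-down j≤q)) (aboveᵗ _ j≤q)
      ... | after j = subst (Above m) (sym prefixᵈ) (above-E-swap m d t (take j f) (subst (Above m) prefixᵘ (aboveᵘ (p + (q + suc j)))))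
        where
        prefixᵈ : take (suc (p + (q + j))) down ≡ d ++ E ∷ (t ++ take j f)
        prefixᵈ = trans (take-length+-++-∷ d E (t ++ f) (q + j)) (cong (λ x → d ++ E ∷ x) (take-length+-++ t f j))
        prefixᵘ : take (p + (q + suc j)) up ≡ d ++ t ++ E ∷ take j f
        prefixᵘ = trans (take-length+-++ d _ (q + suc j)) (cong (d ++_) (take-length+-++ t (E ∷ f) (suc j)))

    lowering-of-rotation : ∀ {i} → IsDyck m n down → IsR down i (suc p) → IsTouch m down i (suc p + q) →
      Lowering m up i
    lowering-of-rotation {i} (_ , _ , aboveᵈ) Rᵈ Tᵈ = record
      { d = d ; t = t ; f = f ; split = refl ; r-at = Rᵘ
      ; touch-at  = firstReturn⇒touch m up Rᵘ up-bound
                      (Equivalence.from (firstReturn-up⇔down aboveᵗ) (touch⇒firstReturn m down Rᵈ Tᵈ))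
      ; horiz-r≢0 = subst (λ k → horiz m up k ≢ 0) (+-identityʳ p)
                      (λ ≡0 → 0≢1+n (trans (sym ≡0) (horiz-shift z≤n (aboveᵗ 0 z≤n))))
      }
      where
      Rᵘ : IsR up i p
      Rᵘ = Equivalence.from IsR-up⇔down Rᵈ
      aboveᵗ : ∀ j → j ≤ q → Above m (d ++ E ∷ take j t)
      aboveᵗ j j≤q = subst (Above m) (take-down j≤q) (aboveᵈ (suc (p + j)))

    rotation-of-lowering : ∀ {i} → IsDyck m n up → IsR up i p → IsTouch m up i (p + q) → horiz m up p ≢ 0 →
      IsDyck m n down × IsTouch m down i (suc p + q)
    rotation-of-lowering dyck Rᵘ Tᵘ horiz-r≢0 =
      dyck-down dyck aboveᵗ ,
      firstReturn⇒touch m down (Equivalence.to IsR-up⇔down Rᵘ) down-bound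
        (Equivalence.to (firstReturn-up⇔down aboveᵗ) returnᵘ)
      where
      returnᵘ : FirstReturn (horiz m up) p (p + q)
      returnᵘ = touch⇒firstReturn m up Rᵘ Tᵘ
      floor : ∀ j → j ≤ q → horiz m up p ≤ horiz m up (p + j)
      floor j j≤q = firstReturn-floor (horiz-descends m up) (horiz-N m up p (proj₁ Rᵘ)) returnᵘ
                      (p + j) (m≤m+n p j) (+-monoʳ-≤ p j≤q)
      aboveᵗ : ∀ j → j ≤ q → Above m (d ++ E ∷ take j t)
      aboveᵗ j j≤q = excess≢0⇒above-E m d (take j t) λ ≡0 →
        horiz-r≢0 (n≤0⇒n≡0 (subst (horiz m up p ≤_) (trans (cong (excess m) (take-up j≤q)) ≡0) (floor j j≤q)))

module _ (m : ℕ) where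

  covers⇒lowering : ∀ {n D D′} → Covers m n D′ D → Σ ℕ λ i → i ≤ n × Σ (Lowering m D i) λ L → lowered L ≡ D′
  covers⇒lowering (dyck , i , _ , i≤n , d , t , f , refl , Rᵈ , Tᵈ , refl)
    with segment-starts-N m _ t f (drop-length-++-∷ d E (t ++ f)) Rᵈ Tᵈ
  ... | s , refl = i , i≤n , Rotation.lowering-of-rotation m d s f dyck Rᵈ Tᵈ , refl

  lowering⇒covers : ∀ {n D i} → IsDyck m n D → i ≤ n → (L : Lowering m D i) → Covers m n (lowered L) D
  lowering⇒covers dyck i≤n record { d = d ; t = t ; f = f ; split = refl ; r-at = Rᵘ ; touch-at = Tᵘ ; horiz-r≢0 = ≢0 }
    with segment-starts-N m _ t (E ∷ f) (drop-length-++ d _) Rᵘ Tᵘ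
  ... | s , refl with Rotation.rotation-of-lowering m d s f dyck Rᵘ Tᵘ ≢0
  ...   | dyckᵈ , Tᵈ =
    dyckᵈ , _ , subst (1 ≤_) (proj₂ Rᵘ) (s≤s z≤n) , i≤n , d , t , f , refl ,
    Equivalence.to (Rotation.IsR-up⇔down m d s f) Rᵘ , Tᵈ , refl

  lowering-unique : ∀ {D i} (L L′ : Lowering m D i) → lowered L ≡ lowered L′
  lowering-unique {D}
    record { d = d  ; t = t  ; split = split  ; r-at = R  ; touch-at = T }
    record { d = d′ ; t = t′ ; split = split′ ; r-at = R′ ; touch-at = T′ }
    with ++-injective d d′ (IsR-unique D R R′) (trans (sym split) split′)
  ... | refl , rest with ++-injective t t′ (+-cancelˡ-≡ (length d) _ _ (touch-unique m D T T′)) rest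
  ...   | refl , refl = refl

  lowering⇒1<i : ∀ {D i} → Lowering m D i → 1 < i
  lowering⇒1<i {D} record { d = d ; r-at = (_ , count) ; horiz-r≢0 = ≢0 } =
    subst (1 <_) count (s≤s (n≢0⇒n>0 λ countN≡0 → ≢0 (begin
      m * countN (take (length d) D) ∸ x ≡⟨ cong (λ c → m * c ∸ x) countN≡0 ⟩
      m * 0 ∸ x                          ≡⟨ cong (_∸ x) (*-zeroʳ m) ⟩
      0 ∸ x                              ≡⟨ 0∸n≡0 x ⟩
      0                                  ∎)))
    where
    open ≡-Reasoning
    x : ℕ
    x = countE (take (length d) D)

  TouchHitAt : Path → ℕ → Set
  TouchHitAt D i =
    (∀ a b → IsTouch m D i a → IsHit m D i b → point D a ≡ point D b) × (∀ r → IsR D i r → horiz m D r ≢ 0)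

  lowering⇒touchHit : ∀ {D i} → Lowering m D i → TouchHitAt D i
  lowering⇒touchHit {D} record { d = d ; t = t ; f = f ; split = split ; r-at = R ; touch-at = T ; horiz-r≢0 = ≢0 } =
    (λ a b Tᵃ Hᵇ → cong (point D) (trans (touch-unique m D Tᵃ T) (sym (hit-at-touch m D {b = b} T east Hᵇ)))) ,
    (λ r R′ → subst (λ r → horiz m D r ≢ 0) (IsR-unique D {a = length d} {r} R R′) ≢0)
    where
    east : EastOrFinal D (length d + length t)
    east = inj₂ (trans (cong (head ∘ drop (length d + length t)) split)
                       (cong head (trans (drop-length+-++ d _ (length t)) (drop-length-++ t (E ∷ f)))))

  lowering-at : ∀ {D i r k} → IsR D i r → IsTouch m D i k → horiz m D r ≢ 0 → head (drop k D) ≡ just E →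
    Lowering m D i
  lowering-at {D} {i} {r} {k} R T ≢0 east
    with splitAt₃ D r k (<⇒≤ (proj₁ (touch⇒firstReturn m D R T))) east
  ... | d , t , f , split , refl , |d|+|t|≡k = record
    { d = d ; t = t ; f = f ; split = split ; r-at = R
    ; touch-at = subst (IsTouch m D i) (sym |d|+|t|≡k) T ; horiz-r≢0 = ≢0 }

  descent-after-R : ∀ {n} D {i r} → IsDyck m n D → IsR D i r → horiz m D r ≢ 0 →
    Σ ℕ λ k → r < k × k < length D × horiz m D k ≡ horiz m D r × head (drop k D) ≡ just E
  descent-after-R D {r = r} dyck R ≢0
    with crossing (horiz-descends m D) (length D) (IsR⇒< D R) ≤-refl
                  (subst (_< horiz m D r) (sym (horiz-final m D dyck)) (n≢0⇒n>0 ≢0))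
  ... | k , r≤k , k<len , hk≡hr , hsk<hr with m≤n⇒m<n∨m≡n r≤k
  ...   | inj₂ refl = contradiction (horiz-N m D r (proj₁ R)) (<⇒≱ hsk<hr)
  ...   | inj₁ r<k  = k , r<k , k<len , hk≡hr , horiz-decrease⇒E m D k (subst (horiz m D (suc k) <_) (sym hk≡hr) hsk<hr)

  touchHit⇒lowering : ∀ {n D i} → IsDyck m n D → 1 < i → i ≤ n → TouchHitAt D i → Lowering m D i
  touchHit⇒lowering {n} {D} {i} dyck@(#N , _) 1<i i≤n (touch≡hit , r≢0)
    with IsR-exists D (<⇒≤ 1<i) (subst (i ≤_) (sym #N) i≤n)
  ... | r , R with descent-after-R D {r = r} dyck R (r≢0 r R)
  ...   | k , r<k , k<len , hk≡hr , east with firstReturn-exists (horiz m D) r<k hk≡hr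
  ...     | tp , tp≤k , return with hit-exists m D {r = r} R r<k (<⇒≤ k<len) hk≡hr (inj₂ east)
  ...       | hp , H@(_ , _ , _ , hp≤len , _ , eastOrFinal , _) =
    lowering-at {r = r} R T (r≢0 r R) (tp-east (subst (EastOrFinal D) (sym tp≡hp) eastOrFinal))
    where
    tp≤len : tp ≤ length D
    tp≤len = ≤-trans tp≤k (<⇒≤ k<len)
    T : IsTouch m D i tp
    T = firstReturn⇒touch m D {r = r} R tp≤len return
    tp≡hp : tp ≡ hp
    tp≡hp = point-injective D tp≤len hp≤len (touch≡hit tp hp T H)
    tp-east : EastOrFinal D tp → head (drop tp D) ≡ just E
    tp-east (inj₂ east′) = east′
    tp-east (inj₁ final) =
      contradiction (trans (sym (proj₁ (proj₂ return))) (trans (cong (horiz m D) final) (horiz-final m D dyck))) (r≢0 r R)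

commonPrefix : Path → Path → Path
commonPrefix (x ∷ a) (y ∷ b) with x ≟ₛ y
... | yes _ = x ∷ commonPrefix a b
... | no  _ = []
commonPrefix _ _ = []

commonPrefix-diverging : ∀ (d X Y : Path) → commonPrefix (d ++ E ∷ X) (d ++ N ∷ Y) ≡ d
commonPrefix-diverging []      X Y = refl
commonPrefix-diverging (x ∷ d) X Y with x ≟ₛ x
... | yes _  = cong (x ∷_) (commonPrefix-diverging d X Y)
... | no x≢x = contradiction refl x≢x

-- The index i of a cover D′ ⋖ D = D′↑ᵢ, read off from where D′ and D first differ.
coverIndex : Path → Path → ℕ
coverIndex D D′ = suc (countN (commonPrefix D′ D))

coverIndex-lowered : ∀ {m D i} (L : Lowering m D i) → coverIndex D (lowered L) ≡ i
coverIndex-lowered {m} record { d = d ; t = t ; f = f ; split = refl ; r-at = R ; touch-at = T }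
  with segment-starts-N m _ t (E ∷ f) (drop-length-++ d _) R T
... | s , refl = begin
  suc (countN (commonPrefix (d ++ E ∷ (N ∷ s ++ f)) (d ++ N ∷ s ++ E ∷ f))) ≡⟨ cong (suc ∘ countN) (commonPrefix-diverging d _ _) ⟩
  suc (countN d)                                                            ≡⟨ cong (suc ∘ countN) (sym (take-length-++ d _)) ⟩
  suc (countN (take (length d) (d ++ N ∷ s ++ E ∷ f)))                      ≡⟨ proj₂ R ⟩
  _                                                                         ∎
  where open ≡-Reasoning

indices : ℕ → List ℕ
indices n = applyUpTo (2 +_) (n ∸ 1)

∈-indices⁺ : ∀ {n i} → 1 < i → i ≤ n → i ∈ indices n
∈-indices⁺ {n} {suc (suc j)} (s≤s (s≤s z≤n)) i≤n = ∈-applyUpTo⁺ (2 +_) (∸-monoˡ-≤ 1 i≤n)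

∈-indices⁻ : ∀ {n i} → i ∈ indices n → 1 < i × i ≤ n
∈-indices⁻ {suc n} i∈ with ∈-applyUpTo⁻ (2 +_) i∈
... | j , j<n , refl = s≤s (s≤s z≤n) , s≤s j<n

unique-indices : ∀ n → Unique (indices n)
unique-indices n = UniqueP.applyUpTo⁺₁ (2 +_) (n ∸ 1) (λ i<j _ → <⇒≢ (+-monoʳ-< 2 i<j))

module _ (m n : ℕ) (D : Path) (dyck : IsDyck m n D) where

  coverIndex-injective : ∀ {D₁ D₂} → Covers m n D₁ D → Covers m n D₂ D → coverIndex D D₁ ≡ coverIndex D D₂ → D₁ ≡ D₂
  coverIndex-injective c₁ c₂ eq with covers⇒lowering m c₁ | covers⇒lowering m c₂
  ... | _ , _ , L₁ , refl | _ , _ , L₂ , refl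
    with trans (sym (coverIndex-lowered L₁)) (trans eq (coverIndex-lowered L₂))
  ...   | refl = lowering-unique m L₁ L₂

  coverIndex-∈ : ∀ {D′} → Covers m n D′ D → coverIndex D D′ ∈ indices n
  coverIndex-∈ cover with covers⇒lowering m cover
  ... | i , i≤n , L , refl = subst (_∈ indices n) (sym (coverIndex-lowered L)) (∈-indices⁺ (lowering⇒1<i m L) i≤n)

  lowerings⇒inDegree : (∀ i → 1 < i → i ≤ n → Lowering m D i) → InDegree m n D (n ∸ 1)
  lowerings⇒inDegree lowering = covered , unique-covered , (λ D′ → mk⇔ (∈⇒covers D′) (covers⇒∈ D′)) , length-covered
    where
    lowerAt : ∀ {i} → i ∈ indices n → Lowering m D i
    lowerAt {i} i∈ = lowering i (proj₁ (∈-indices⁻ {n} i∈)) (proj₂ (∈-indices⁻ {n} i∈))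
    covered : List Path
    covered = mapWith∈ (indices n) (λ i∈ → lowered (lowerAt i∈))
    coverIndices : map (coverIndex D) covered ≡ indices n
    coverIndices = begin
      map (coverIndex D) covered                                   ≡⟨ map-mapWith∈ (indices n) (λ i∈ → lowered (lowerAt i∈)) (coverIndex D) ⟩
      mapWith∈ (indices n) (λ i∈ → coverIndex D (lowered (lowerAt i∈))) ≡⟨ mapWith∈-cong (indices n) _ _ (λ i∈ → coverIndex-lowered (lowerAt i∈)) ⟩
      mapWith∈ (indices n) (λ {i} _ → i)                           ≡⟨ mapWith∈-id (indices n) ⟩
      indices n                                                    ∎
      where open ≡-Reasoning
    unique-covered : Unique covered
    unique-covered = UniqueP.map⁻ (subst Unique (sym coverIndices) (unique-indices n))
    length-covered : length covered ≡ n ∸ 1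
    length-covered = trans (sym (length-map (coverIndex D) covered))
                           (trans (cong length coverIndices) (length-applyUpTo (2 +_) (n ∸ 1)))
    ∈⇒covers : ∀ D′ → D′ ∈ covered → Covers m n D′ D
    ∈⇒covers D′ D′∈ with AnyP.mapWith∈⁻ (indices n) _ D′∈
    ... | i , i∈ , refl = lowering⇒covers m dyck (proj₂ (∈-indices⁻ i∈)) (lowerAt i∈)
    covers⇒∈ : ∀ D′ → Covers m n D′ D → D′ ∈ covered
    covers⇒∈ D′ cover with covers⇒lowering m cover
    ... | i , i≤n , L , refl = let i∈ = ∈-indices⁺ (lowering⇒1<i m L) i≤n in
      AnyP.mapWith∈⁺ (λ i∈ → lowered (lowerAt i∈)) (i , i∈ , lowering-unique m L (lowerAt i∈))

  lowering-at-coverIndex : ∀ {D′} → Covers m n D′ D → Lowering m D (coverIndex D D′)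
  lowering-at-coverIndex cover with covers⇒lowering m cover
  ... | _ , _ , L , refl = subst (Lowering m D) (sym (coverIndex-lowered L)) L

  module _ {covered : List Path} (covers : ∀ {D′} → D′ ∈ covered → Covers m n D′ D) where

    coverIndices-⊆ : map (coverIndex D) covered ⊆ indices n
    coverIndices-⊆ k∈ with ∈-map⁻ (coverIndex D) k∈
    ... | D′ , D′∈ , refl = coverIndex-∈ (covers D′∈)

    -- The indices of the covered paths are distinct and lie in (1, n]; if
    -- there are n ∸ 1 of them, every index in (1, n] occurs.
    coverIndices-complete : Unique covered → length covered ≡ n ∸ 1 →
      ∀ {i} → 1 < i → i ≤ n → i ∈ map (coverIndex D) covered
    coverIndices-complete unique length≡ {i} 1<i i≤n with i ∈? map (coverIndex D) covered
    ... | yes i∈ = i∈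
    ... | no  i∉ = contradiction (unique-⊆⇒length≤ _≟_ unique-i∷ i∷⊆) (<⇒≱ (begin-strict
      length (indices n)                      ≡⟨ length-applyUpTo (2 +_) (n ∸ 1) ⟩
      n ∸ 1                                   ≡⟨ sym length≡ ⟩
      length covered                          ≡⟨ sym (length-map (coverIndex D) covered) ⟩
      length (map (coverIndex D) covered)     <⟨ n<1+n _ ⟩
      length (i ∷ map (coverIndex D) covered) ∎))
      where
      open ≤-Reasoning
      unique-i∷ : Unique (i ∷ map (coverIndex D) covered)
      unique-i∷ = All.¬Any⇒All¬ _ i∉ ∷ unique-map-injectiveOn coverIndex-injective (All.tabulate covers) unique
      i∷⊆ : (i ∷ map (coverIndex D) covered) ⊆ indices n
      i∷⊆ (here refl) = ∈-indices⁺ 1<i i≤n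
      i∷⊆ (there k∈)  = coverIndices-⊆ k∈

  inDegree⇒lowerings : InDegree m n D (n ∸ 1) → ∀ i → 1 < i → i ≤ n → Lowering m D i
  inDegree⇒lowerings (covered , unique , enumerates , length≡) i 1<i i≤n =
    lowering-of-member (coverIndices-complete covers unique length≡ 1<i i≤n)
    where
    covers : ∀ {D′} → D′ ∈ covered → Covers m n D′ D
    covers {D′} = Equivalence.to (enumerates D′)
    lowering-of-member : ∀ {i} → i ∈ map (coverIndex D) covered → Lowering m D i
    lowering-of-member i∈ with ∈-map⁻ (coverIndex D) i∈
    ... | D′ , D′∈ , refl = lowering-at-coverIndex (covers D′∈)

mainTheorem6 : (m n : ℕ) → 1 ≤ m → 1 ≤ n → (D : Path) → IsDyck m n D →
    (InDegree m n D (n ∸ 1) ⇔ TouchHitCond m n D)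
mainTheorem6 m n _ _ D dyck = mk⇔
  (λ inDegree i 1<i i≤n → lowering⇒touchHit m (inDegree⇒lowerings m n D dyck inDegree i 1<i i≤n))
  (λ cond → lowerings⇒inDegree m n D dyck λ i 1<i i≤n → touchHit⇒lowering m dyck 1<i i≤n (cond i 1<i i≤n))
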